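{- Let $d\ge 2$, $n\ge d$ and $k\ge 1$ be integers, and put $c=\left\lceil n/\sum_{j=0}^k d^j\right\rceil$. If $(d^{k-1}+d^k)\,c\ge n$ or $d^{k-1}c\ge \lceil n/(d+1)\rceil$, then $\gamma_k(G_K(n,d)) = c$.
   Context: The generalized Kautz digraph $G_K(n,d)$ has vertex set $\{0,1,\dots,n-1\}$ and an arc $(x,y)$ whenever $y\equiv -dx-i \pmod n$ for some $1\le i\le d$ (self-loops allowed, no multiple arcs). A set $D$ of vertices of a digraph $G$ is a distance $k$-dominating set if every vertex $v\notin D$ has some $u\in D$ with a directed path from $u$ to $v$ of length at most $k$. $\gamma_k(G)$ denotes the minimum cardinality of a distance $k$-dominating set of $G$. -}

module Defs where

open import Data.Nat using (ℕ; zero; suc; _+_; _*_; _∸_; _^_; _≤_; NonZero)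
open import Data.Nat.DivMod using (_/_)
open import Data.Nat.Divisibility using (_∣_)
open import Data.Fin using (Fin; toℕ)
open import Data.Fin.Subset using (Subset; _∈_; _∉_; ∣_∣)
open import Data.Product using (Σ; ∃; _×_)
open import Relation.Binary.PropositionalEquality using (_≡_)

-- ceiling division ⌈ a / b ⌉ = (a + b - 1) div b ; only used with b ≠ 0
-- (the b = 0 clause is a junk value that never occurs in the statement)
⌈_/_⌉ : ℕ → ℕ → ℕ
⌈ a / zero ⌉ = 0
⌈ a / suc b ⌉ = (a + suc b ∸ 1) / suc b

geomSum : ℕ → ℕ → ℕ
geomSum d zero    = 1
geomSum d (suc k) = geomSum d k + d ^ suc k

-- arc (x,y) in the generalized Kautz digraph G_K(n,d):
-- y ≡ -d x - i (mod n) for some 1 ≤ i ≤ d, i.e. n ∣ y + d x + i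
KArc : (n d : ℕ) → Fin n → Fin n → Set
KArc n d x y = Σ ℕ λ i → (1 ≤ i) × (i ≤ d) × (n ∣ (toℕ y + d * toℕ x + i))

-- directed walk from u to v of length at most k
data Reach (n d : ℕ) : ℕ → Fin n → Fin n → Set where
  here : ∀ {k u} → Reach n d k u u
  step : ∀ {k u w v} → KArc n d u w → Reach n d k w v → Reach n d (suc k) u v

IsDistDom : (n d k : ℕ) → Subset n → Set
IsDistDom n d k D = ∀ v → v ∉ D → Σ (Fin n) λ u → (u ∈ D) × Reach n d k u v

GammaEq : (n d k c : ℕ) → Set
GammaEq n d k c =
  (Σ (Subset n) λ D → IsDistDom n d k D × ∣ D ∣ ≡ c) ×
  (∀ D → IsDistDom n d k D → c ≤ ∣ D ∣)

-- Lower bound: a vertex has at most d out-neighbours, so at most 1 + d + ⋯ + d^k vertices lie within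
-- distance k of it, and a distance-k dominating set D satisfies n ≤ |D| (1 + d + ⋯ + d^k).
-- Upper bound: take D = {0, …, c - 1}. Every vertex v has the in-neighbours ⌊(n - 1 - v)/d⌋ and
-- n - 1 - ⌊v/d⌋, so if D reaches all v < d^j c within j steps it reaches all v ≥ n - d^(j+1) c within
-- j + 1 steps, and conversely. Hence after k - 1 and k steps D reaches an initial and a final
-- interval of lengths d^(k-1) c and d^k c (in some order), which together cover all n vertices as soon as
-- (d^(k-1) + d^k) c ≥ n; the second hypothesis implies this one since n ≤ (d + 1) ⌈n/(d+1)⌉.
module Submission where

open import Defs
open import Data.Nat using (ℕ; zero; suc; _+_; _*_; _∸_; _^_; _≤_; _≥_; _<_; z≤n; s≤s; z<s; NonZero; >-nonZero; _<?_)
open import Data.Nat.Properties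
open import Data.Nat.DivMod
  using (_/_; _%_; m%n<n; m%n%n≡m%n; %-distribˡ-+; n%n≡0; m≡m%n+[m/n]*n; m<n*o⇒m/o<n; m/n≤m)
open import Data.Nat.Divisibility using (_∣_; >⇒∤; ∣m+n∣m⇒∣n; m%n≡0⇒n∣m; divides)
open import Data.Nat.Tactic.RingSolver using (solve-∀)
open import Algebra.Properties.CommutativeSemigroup +-commutativeSemigroup using (xy∙z≈xz∙y)
open import Data.Fin using (Fin; toℕ; fromℕ<) renaming (zero to fzero; suc to fsuc)
open import Data.Fin.Properties using (toℕ-fromℕ<; toℕ-injective; toℕ<n; injective⇒≤)
open import Data.Fin.Subset using (Subset; inside; outside; ⊥; ∣_∣) renaming (_∈_ to _∈ₛ_)
open import Data.Fin.Subset.Properties using (_∈?_; ∣⊥∣≡0)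
open import Data.Vec using ([]; _∷_; here; there)
open import Data.List using (List; []; _∷_; length; map; concatMap; applyUpTo; lookup)
open import Data.List.Properties using (length-map; length-++; length-applyUpTo)
open import Data.List.Membership.Propositional using (_∈_; lose)
open import Data.List.Membership.Propositional.Properties using (∈-map⁺; ∈-concatMap⁺; ∈-applyUpTo⁺)
open import Data.List.Relation.Unary.Any using (index) renaming (here to ahere; there to athere)
open import Data.List.Relation.Unary.Any.Properties using (lookup-index)
open import Data.Product using (Σ; _×_; _,_)
open import Data.Sum using (_⊎_; inj₁; inj₂; [_,_]′)
open import Function using (id; _∘_)
open import Relation.Binary.PropositionalEquality
open import Relation.Nullary using (yes; no; contradiction)

-- Rewriting with +-suc makes ⌈ n / suc g ⌉ compute to (n + g) / suc g.
⌈/⌉-≤ : ∀ {n m} g .{{_ : NonZero g}} → n ≤ m * g → ⌈ n / g ⌉ ≤ m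
⌈/⌉-≤ {n} {m} (suc g) n≤mg rewrite +-suc n g =
  <⇒≤pred (m<n*o⇒m/o<n {n = suc m}
    (subst (n + g <_) (+-comm (m * suc g) (suc g)) (+-mono-≤-< n≤mg (n<1+n g))))

≤⌈/⌉* : ∀ n g .{{_ : NonZero g}} → n ≤ ⌈ n / g ⌉ * g
≤⌈/⌉* n (suc g) rewrite +-suc n g =
  +-cancelʳ-≤ g n _ (begin
    n + g                        ≡⟨ m≡m%n+[m/n]*n (n + g) (suc g) ⟩
    (n + g) % suc g + q * suc g  ≤⟨ +-monoˡ-≤ (q * suc g) (<⇒≤pred (m%n<n (n + g) (suc g))) ⟩
    g + q * suc g                ≡⟨ +-comm g (q * suc g) ⟩
    q * suc g + g                ∎)
  where
  open ≤-Reasoning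
  q : ℕ
  q = (n + g) / suc g

geomSum-suc : ∀ d k → suc (d * geomSum d k) ≡ geomSum d (suc k)
geomSum-suc d zero = refl
geomSum-suc d (suc k) = begin
  suc (d * (geomSum d k + d ^ suc k))     ≡⟨ cong suc (*-distribˡ-+ d (geomSum d k) (d ^ suc k)) ⟩
  suc (d * geomSum d k) + d * d ^ suc k   ≡⟨ cong (_+ d * d ^ suc k) (geomSum-suc d k) ⟩
  geomSum d (suc k) + d ^ suc (suc k)     ∎
  where open ≡-Reasoning

1≤geomSum : ∀ d k → 1 ≤ geomSum d k
1≤geomSum d zero = ≤-refl
1≤geomSum d (suc k) = ≤-trans (1≤geomSum d k) (m≤m+n _ _)

∣∧<⇒≡0 : ∀ {n t} → n ∣ t → t < n → t ≡ 0
∣∧<⇒≡0 {t = zero} _ _ = refl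
∣∧<⇒≡0 {t = suc t} n∣t t<n = contradiction n∣t (>⇒∤ t<n)

residue-unique-≤ : ∀ {n v w a} → v ≤ w → w < n → n ∣ v + a → n ∣ w + a → v ≡ w
residue-unique-≤ {n} {v} {w} {a} v≤w w<n n∣v+a n∣w+a =
  ≤-antisym v≤w (m∸n≡0⇒m≤n (∣∧<⇒≡0 n∣w∸v (≤-<-trans (m∸n≤m w v) w<n)))
  where
  v+a+[w∸v]≡w+a : (v + a) + (w ∸ v) ≡ w + a
  v+a+[w∸v]≡w+a = begin
    (v + a) + (w ∸ v)  ≡⟨ xy∙z≈xz∙y v a (w ∸ v) ⟩
    (v + (w ∸ v)) + a  ≡⟨ cong (_+ a) (m+[n∸m]≡n v≤w) ⟩
    w + a              ∎
    where open ≡-Reasoning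
  n∣w∸v : n ∣ w ∸ v
  n∣w∸v = ∣m+n∣m⇒∣n (subst (n ∣_) (sym v+a+[w∸v]≡w+a) n∣w+a) n∣v+a

residue-unique : ∀ {n v w a} → v < n → w < n → n ∣ v + a → n ∣ w + a → v ≡ w
residue-unique {v = v} {w} v<n w<n n∣v+a n∣w+a with ≤-total v w
... | inj₁ v≤w = residue-unique-≤ v≤w w<n n∣v+a n∣w+a
... | inj₂ w≤v = sym (residue-unique-≤ w≤v v<n n∣w+a n∣v+a)

length-concatMap-≤ : ∀ {A B : Set} (f : A → List B) {b} → (∀ x → length (f x) ≤ b) →
                     ∀ xs → length (concatMap f xs) ≤ length xs * b
length-concatMap-≤ f f≤b [] = z≤n
length-concatMap-≤ f f≤b (x ∷ xs) rewrite length-++ (f x) {concatMap f xs} =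
  +-mono-≤ (f≤b x) (length-concatMap-≤ f f≤b xs)

∈-concatMap : ∀ {A B : Set} (f : A → List B) {x y xs} → x ∈ xs → y ∈ f x → y ∈ concatMap f xs
∈-concatMap f x∈xs y∈fx = ∈-concatMap⁺ f (lose x∈xs y∈fx)

enumeration⇒≤length : ∀ {m} (L : List (Fin m)) → (∀ v → v ∈ L) → m ≤ length L
enumeration⇒≤length L enum = injective⇒≤ {f = λ v → index (enum v)} λ {v} {w} eq → begin
  v                         ≡⟨ lookup-index (enum v) ⟩
  lookup L (index (enum v)) ≡⟨ cong (lookup L) eq ⟩
  lookup L (index (enum w)) ≡⟨ lookup-index (enum w) ⟨
  w                         ∎
  where open ≡-Reasoning

members : ∀ {m} → Subset m → List (Fin m)
members [] = []
members (inside ∷ p) = fzero ∷ map fsuc (members p)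
members (outside ∷ p) = map fsuc (members p)

length-members : ∀ {m} (p : Subset m) → length (members p) ≡ ∣ p ∣
length-members [] = refl
length-members (inside ∷ p) = cong suc (trans (length-map fsuc (members p)) (length-members p))
length-members (outside ∷ p) = trans (length-map fsuc (members p)) (length-members p)

∈⇒∈members : ∀ {m} {x : Fin m} (p : Subset m) → x ∈ₛ p → x ∈ members p
∈⇒∈members (inside ∷ p) here = ahere refl
∈⇒∈members (inside ∷ p) (there x∈p) = athere (∈-map⁺ fsuc (∈⇒∈members p x∈p))
∈⇒∈members (outside ∷ p) (there x∈p) = ∈-map⁺ fsuc (∈⇒∈members p x∈p)

initialSegment : ∀ m → ℕ → Subset m
initialSegment m zero = ⊥
initialSegment zero (suc c) = []
initialSegment (suc m) (suc c) = inside ∷ initialSegment m c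

∣initialSegment∣ : ∀ {m c} → c ≤ m → ∣ initialSegment m c ∣ ≡ c
∣initialSegment∣ {m} {zero} _ = ∣⊥∣≡0 m
∣initialSegment∣ {suc m} {suc c} (s≤s c≤m) = cong suc (∣initialSegment∣ c≤m)

<⇒∈initialSegment : ∀ {m c} (i : Fin m) → toℕ i < c → i ∈ₛ initialSegment m c
<⇒∈initialSegment {c = suc c} fzero _ = here
<⇒∈initialSegment {c = suc c} (fsuc i) (s≤s i<c) = there (<⇒∈initialSegment i i<c)

Reach-weaken : ∀ {n d j u v} → Reach n d j u v → Reach n d (suc j) u v
Reach-weaken here = here
Reach-weaken (step a r) = step a (Reach-weaken r)

Reach-snoc : ∀ {n d j u x v} → Reach n d j u x → KArc n d x v → Reach n d (suc j) u v
Reach-snoc here a = step a here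
Reach-snoc (step b r) a = step b (Reach-snoc r a)

split-cover : ∀ {n a b} {P : Fin n → Set} → (∀ v → toℕ v < a → P v) → (∀ v → n ≤ toℕ v + b → P v) →
              n ≤ a + b → ∀ v → P v
split-cover {a = a} {b} low high n≤a+b v with toℕ v <? a
... | yes v<a = low v v<a
... | no v≮a = high v (≤-trans n≤a+b (+-monoˡ-≤ b (≮⇒≥ v≮a)))

second-condition⇒first : ∀ n d k c → ⌈ n / suc d ⌉ ≤ d ^ k * c → n ≤ (d ^ k + d ^ suc k) * c
second-condition⇒first n d k c ⌈n/d+1⌉≤ = begin
  n                          ≤⟨ ≤⌈/⌉* n (suc d) ⟩
  ⌈ n / suc d ⌉ * suc d      ≤⟨ *-monoˡ-≤ (suc d) ⌈n/d+1⌉≤ ⟩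
  d ^ k * c * suc d          ≡⟨ distribute (d ^ k) c d ⟩
  (d ^ k + d ^ suc k) * c    ∎
  where
  open ≤-Reasoning
  distribute : ∀ a c d → a * c * suc d ≡ (a + d * a) * c
  distribute = solve-∀

module KautzDigraph (n d : ℕ) .{{_ : NonZero n}} where

  negate : ℕ → Fin n
  negate a = fromℕ< (m%n<n (n ∸ a % n) n)

  n∣negate+ : ∀ a → n ∣ toℕ (negate a) + a
  n∣negate+ a rewrite toℕ-fromℕ< (m%n<n (n ∸ a % n) n) = m%n≡0⇒n∣m (w + a) n (begin
    (w + a) % n                  ≡⟨ %-distribˡ-+ w a n ⟩
    (w % n + r) % n              ≡⟨ cong₂ (λ y z → (y + z) % n) (m%n%n≡m%n (n ∸ r) n) (sym (m%n%n≡m%n a n)) ⟩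
    ((n ∸ r) % n + r % n) % n    ≡⟨ %-distribˡ-+ (n ∸ r) r n ⟨
    (n ∸ r + r) % n              ≡⟨ cong (_% n) (m∸n+n≡m (<⇒≤ (m%n<n a n))) ⟩
    n % n                        ≡⟨ n%n≡0 n ⟩
    0                            ∎)
    where
    open ≡-Reasoning
    r : ℕ
    r = a % n
    w : ℕ
    w = (n ∸ r) % n

  successor : Fin n → ℕ → Fin n
  successor x i = negate (d * toℕ x + i)

  successors : Fin n → List (Fin n)
  successors x = applyUpTo (λ j → successor x (suc j)) d

  arc⇒∈successors : ∀ {x y} → KArc n d x y → y ∈ successors x
  arc⇒∈successors {x} {y} (suc j , _ , j<d , n∣) =
    subst (_∈ successors x) (sym y≡) (∈-applyUpTo⁺ (λ j → successor x (suc j)) j<d)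
    where
    y≡ : y ≡ successor x (suc j)
    y≡ = toℕ-injective (residue-unique (toℕ<n y) (toℕ<n (successor x (suc j)))
           (subst (n ∣_) (+-assoc (toℕ y) (d * toℕ x) (suc j)) n∣) (n∣negate+ (d * toℕ x + suc j)))

  ball : ℕ → Fin n → List (Fin n)
  ball zero u = u ∷ []
  ball (suc k) u = u ∷ concatMap (ball k) (successors u)

  centre∈ball : ∀ k u → u ∈ ball k u
  centre∈ball zero u = ahere refl
  centre∈ball (suc k) u = ahere refl

  Reach⇒∈ball : ∀ {k u v} → Reach n d k u v → v ∈ ball k u
  Reach⇒∈ball {k} {u} here = centre∈ball k u
  Reach⇒∈ball (step arc r) = athere (∈-concatMap (ball _) (arc⇒∈successors arc) (Reach⇒∈ball r))

  length-ball : ∀ k u → length (ball k u) ≤ geomSum d k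
  length-ball zero u = ≤-refl
  length-ball (suc k) u = begin
    suc (length (concatMap (ball k) (successors u)))  ≤⟨ s≤s (length-concatMap-≤ (ball k) (length-ball k) (successors u)) ⟩
    suc (length (successors u) * geomSum d k)          ≡⟨ cong (λ m → suc (m * geomSum d k)) (length-applyUpTo _ d) ⟩
    suc (d * geomSum d k)                              ≡⟨ geomSum-suc d k ⟩
    geomSum d (suc k)                                  ∎
    where open ≤-Reasoning

  dominating⇒≤ : ∀ k D → IsDistDom n d k D → n ≤ ∣ D ∣ * geomSum d k
  dominating⇒≤ k D dom = begin
    n                                         ≤⟨ enumeration⇒≤length (concatMap (ball k) (members D)) covered ⟩
    length (concatMap (ball k) (members D))   ≤⟨ length-concatMap-≤ (ball k) (length-ball k) (members D) ⟩
    length (members D) * geomSum d k          ≡⟨ cong (_* geomSum d k) (length-members D) ⟩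
    ∣ D ∣ * geomSum d k                       ∎
    where
    open ≤-Reasoning
    covered : ∀ v → v ∈ concatMap (ball k) (members D)
    covered v with v ∈? D
    ... | yes v∈D = ∈-concatMap (ball k) (∈⇒∈members D v∈D) (centre∈ball k v)
    ... | no v∉D with dom v v∉D
    ... | u , u∈D , r = ∈-concatMap (ball k) (∈⇒∈members D u∈D) (Reach⇒∈ball r)

  module _ .{{_ : NonZero d}} where

    lowPredecessor : ∀ v → Σ (Fin n) λ x → toℕ x ≡ (n ∸ suc (toℕ v)) / d × KArc n d x v
    lowPredecessor v = fromℕ< x<n , toℕ-fromℕ< x<n , suc (t % d) , s≤s z≤n , m%n<n t d , divides 1 (begin
      V + d * toℕ (fromℕ< x<n) + suc (t % d)  ≡⟨ cong (λ x → V + d * x + suc (t % d)) (toℕ-fromℕ< x<n) ⟩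
      V + d * (t / d) + suc (t % d)           ≡⟨ rearrange V (t / d) (t % d) d ⟩
      suc V + (t % d + t / d * d)             ≡⟨ cong (suc V +_) (m≡m%n+[m/n]*n t d) ⟨
      suc V + t                               ≡⟨ m+[n∸m]≡n (toℕ<n v) ⟩
      n                                       ≡⟨ *-identityˡ n ⟨
      1 * n                                   ∎)
      where
      open ≡-Reasoning
      V : ℕ
      V = toℕ v
      t : ℕ
      t = n ∸ suc V
      x<n : t / d < n
      x<n = ≤-<-trans (m/n≤m t d) (∸-monoʳ-< z<s (toℕ<n v))
      rearrange : ∀ V q r d → V + d * q + suc r ≡ suc V + (r + q * d)
      rearrange = solve-∀

    highPredecessor : ∀ v → Σ (Fin n) λ x → toℕ x ≡ n ∸ suc (toℕ v / d) × KArc n d x v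
    highPredecessor v = fromℕ< x<n , toℕ-fromℕ< x<n , d ∸ r , m<n⇒0<n∸m r<d , m∸n≤m d r , divides d (begin
      V + d * toℕ (fromℕ< x<n) + (d ∸ r)  ≡⟨ cong₂ (λ V x → V + d * x + (d ∸ r)) (m≡m%n+[m/n]*n V d) (toℕ-fromℕ< x<n) ⟩
      r + q * d + d * x + (d ∸ r)         ≡⟨ rearrange r q d x (d ∸ r) ⟩
      (d ∸ r + r) + d * (x + q)           ≡⟨ cong (_+ d * (x + q)) (m∸n+n≡m (<⇒≤ r<d)) ⟩
      d + d * (x + q)                     ≡⟨ *-suc d (x + q) ⟨
      d * suc (x + q)                     ≡⟨ cong (d *_) (+-suc x q) ⟨
      d * (x + suc q)                     ≡⟨ cong (d *_) (m∸n+n≡m q<n) ⟩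
      d * n                               ∎)
      where
      open ≡-Reasoning
      V : ℕ
      V = toℕ v
      q : ℕ
      q = V / d
      r : ℕ
      r = V % d
      x : ℕ
      x = n ∸ suc q
      r<d : r < d
      r<d = m%n<n V d
      q<n : q < n
      q<n = ≤-<-trans (m/n≤m V d) (toℕ<n v)
      x<n : x < n
      x<n = ∸-monoʳ-< z<s q<n
      rearrange : ∀ r q d x s → r + q * d + d * x + s ≡ (s + r) + d * (x + q)
      rearrange = solve-∀

    module InitialSegmentDomination (c : ℕ) where

      Dominated : ℕ → Fin n → Set
      Dominated j v = Σ (Fin n) λ u → u ∈ₛ initialSegment n c × Reach n d j u v

      LowDominated HighDominated : ℕ → Set
      LowDominated j = ∀ v → toℕ v < d ^ j * c → Dominated j v
      HighDominated j = ∀ v → n ≤ toℕ v + d ^ j * c → Dominated j v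

      Dominated-weaken : ∀ {j v} → Dominated j v → Dominated (suc j) v
      Dominated-weaken (u , u∈D , r) = u , u∈D , Reach-weaken r

      Dominated-extend : ∀ {j x v} → Dominated j x → KArc n d x v → Dominated (suc j) v
      Dominated-extend (u , u∈D , r) arc = u , u∈D , Reach-snoc r arc

      d^[1+j]*c≡ : ∀ j → d ^ suc j * c ≡ d ^ j * c * d
      d^[1+j]*c≡ j = trans (*-assoc d (d ^ j) c) (*-comm d (d ^ j * c))

      lowDominated-zero : LowDominated 0
      lowDominated-zero v v<c = v , <⇒∈initialSegment v (subst (toℕ v <_) (+-identityʳ c) v<c) , here

      low⇒high : ∀ j → LowDominated j → HighDominated (suc j)
      low⇒high j low v n≤v+X with lowPredecessor v
      ... | x , x≡ , arc = Dominated-extend (low x (subst (_< d ^ j * c) (sym x≡) (m<n*o⇒m/o<n t<))) arc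
        where
        t< : n ∸ suc (toℕ v) < d ^ j * c * d
        t< = <-≤-trans (∸-monoʳ-< ≤-refl (toℕ<n v))
               (m≤n+o⇒m∸n≤o n (toℕ v) (subst (λ X → n ≤ toℕ v + X) (d^[1+j]*c≡ j) n≤v+X))

      high⇒low : ∀ j → HighDominated j → LowDominated (suc j)
      high⇒low j high v v<X with highPredecessor v
      ... | x , x≡ , arc = Dominated-extend (high x n≤x+) arc
        where
        q< : toℕ v / d < d ^ j * c
        q< = m<n*o⇒m/o<n (subst (toℕ v <_) (d^[1+j]*c≡ j) v<X)
        n≤x+ : n ≤ toℕ x + d ^ j * c
        n≤x+ = begin
          n                                  ≡⟨ m∸n+n≡m (≤-<-trans (m/n≤m (toℕ v) d) (toℕ<n v)) ⟨
          n ∸ suc (toℕ v / d) + suc (toℕ v / d) ≤⟨ +-monoʳ-≤ (n ∸ suc (toℕ v / d)) q< ⟩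
          n ∸ suc (toℕ v / d) + d ^ j * c    ≡⟨ cong (_+ d ^ j * c) x≡ ⟨
          toℕ x + d ^ j * c                  ∎
          where open ≤-Reasoning

      alternation : ∀ j → (LowDominated j × HighDominated (suc j)) ⊎ (HighDominated j × LowDominated (suc j))
      alternation zero = inj₁ (lowDominated-zero , low⇒high 0 lowDominated-zero)
      alternation (suc j) with alternation j
      ... | inj₁ (_ , high) = inj₂ (high , high⇒low (suc j) high)
      ... | inj₂ (_ , low) = inj₁ (low , low⇒high (suc j) low)

      initialSegment-dominating : ∀ k → n ≤ (d ^ k + d ^ suc k) * c → IsDistDom n d (suc k) (initialSegment n c)
      initialSegment-dominating k n≤ v _ with alternation k
      ... | inj₁ (low , high) =
        split-cover (λ v → Dominated-weaken ∘ low v) high (subst (n ≤_) (*-distribʳ-+ c (d ^ k) (d ^ suc k)) n≤) v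
      ... | inj₂ (high , low) =
        split-cover low (λ v → Dominated-weaken ∘ high v)
          (subst (n ≤_) (trans (*-distribʳ-+ c (d ^ k) (d ^ suc k)) (+-comm (d ^ k * c) (d ^ suc k * c))) n≤) v

theorem3p2 : (d n k : ℕ) → (hd : d ≥ 2) → (hn : n ≥ d) → (hk : k ≥ 1) →
    ((d ^ (k ∸ 1) + d ^ k) * ⌈ n / geomSum d k ⌉ ≥ n
    ⊎ d ^ (k ∸ 1) * ⌈ n / geomSum d k ⌉ ≥ ⌈ n / suc d ⌉) →
    GammaEq n d k ⌈ n / geomSum d k ⌉
theorem3p2 zero n k () hn hk cond
theorem3p2 (suc d') zero k hd () hk cond
theorem3p2 (suc d') (suc n') zero hd hn () cond
theorem3p2 d@(suc _) n@(suc _) (suc k) _ _ _ cond =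
  (initialSegment n c , initialSegment-dominating k first-condition , ∣initialSegment∣ c≤n) ,
  λ D dom → ⌈/⌉-≤ g (dominating⇒≤ (suc k) D dom)
  where
  g : ℕ
  g = geomSum d (suc k)
  instance
    g-nonZero : NonZero g
    g-nonZero = >-nonZero (1≤geomSum d (suc k))
  c : ℕ
  c = ⌈ n / g ⌉
  open KautzDigraph n d
  open InitialSegmentDomination c
  c≤n : c ≤ n
  c≤n = ⌈/⌉-≤ g (m≤m*n n g)
  first-condition : n ≤ (d ^ k + d ^ suc k) * c
  first-condition = [ id , second-condition⇒first n d k c ]′ cond
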